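{- For integers $k\ge1$ and $1\le r\le n$, $$T(n,k,r)=\sum_{p=0}^{n-r}\binom{n-1}{p}T(p+1,k,1)\,T(n-p-1,k,r-1),$$ and for $k\ge2$, $n\ge1$, $T(n,k,1)=\sum_{r=1}^{n}T(n,k-1,r)$, with $T(0,k,0)=T(1,k,1)=1$.
   Context: $S(a,b)$ are the Stirling numbers of the second kind and $T(n,k,r)=\sum\prod_{j=1}^{k}S(i_{j-1},i_j)$ over integer tuples $n\ge i_1\ge\dots\ge i_{k-1}\ge r$ with $i_0=n$, $i_k=r$ (so $T(m,k,0)=0$ for $m\ge1$). -}

module Defs where

open import Data.Nat using (ℕ; zero; suc; _+_; _*_; _∸_; _≟_)
open import Relation.Nullary using (yes; no)

S : ℕ → ℕ → ℕ
S zero    zero    = 1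
S zero    (suc b) = 0
S (suc a) zero    = 0
S (suc a) (suc b) = suc b * S a (suc b) + S a b

-- Σ_{i=lo}^{hi} f i   (empty, i.e. 0, when hi < lo)
sumFromTo : ℕ → ℕ → (ℕ → ℕ) → ℕ
sumFromTo lo hi f = go (suc hi ∸ lo) lo
  where
  go : ℕ → ℕ → ℕ
  go zero    i = 0
  go (suc m) i = f i + go m (suc i)

-- T n k r = Σ over n = i₀ ≥ i₁ ≥ … ≥ i_{k-1} ≥ i_k = r of Π_{j=1}^k S(i_{j-1}, i_j).
-- Defined by peeling off i₁ (which ranges over r ≤ i₁ ≤ n);
-- k = 0: the single empty chain exists iff n = r (empty product 1).
T : ℕ → ℕ → ℕ → ℕ
T n zero    r with n ≟ r
... | yes _ = 1
... | no  _ = 0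
T n (suc k) r = sumFromTo r n (λ i → S n i * T i k r)

{-# OPTIONS --safe #-}
module Submission where

-- Identify a sequence with its exponential generating function. The Stirling transform
-- a ↦ (n ↦ Σᵢ S(n,i) aᵢ) sends A(x) to A(eˣ − 1), so it is multiplicative for the binomial
-- convolution. Since T(·,k+1,r) is the Stirling transform of T(·,k,r), induction on k shows
-- that n ↦ T(n,k,r) has egf fʳ/r!, with f the k-fold iterate of eˣ − 1; coefficientwise,
-- (r+1) T(·,k,r+1) = T(·,k,1) ⋆ T(·,k,r). Differentiating, (fʳ/r!)′ = f′ · fʳ⁻¹/(r−1)!, which is
-- the binomial recurrence. The identity for T(n,k,1) comes from peeling the last Stirling
-- factor off a chain instead of the first, since S(i,1) = 1 for i ≥ 1.

open import Defs
open import Data.Nat using (ℕ; zero; suc; _+_; _*_; _∸_; _≤_; _≥_; _<_; z≤n; s≤s; z<s; s<s; _≟_; _≤?_; s≤s⁻¹)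
open import Data.Nat.Properties
open import Data.Nat.Combinatorics using (_C_; nC1≡n; k>n⇒nCk≡0; nCk+nC[k+1]≡[n+1]C[k+1])
open import Data.Nat.Tactic.RingSolver using (solve-∀)
open import Data.Product using (_×_; _,_)
open import Data.Sum using (inj₁; inj₂)
open import Function using (_∘_)
open import Relation.Binary.PropositionalEquality
open import Relation.Nullary using (yes; no; Dec; contradiction)
import Algebra.Properties.CommutativeSemigroup as CommSemigroupProperties
open CommSemigroupProperties +-commutativeSemigroup
  using (interchange) renaming (x∙yz≈y∙xz to x+[y+z]≡y+[x+z])
open CommSemigroupProperties *-commutativeSemigroup
  using () renaming (x∙yz≈y∙xz to x*[y*z]≡y*[x*z])
open ≡-Reasoning

Seq : Set
Seq = ℕ → ℕ

Σ< : ℕ → Seq → ℕ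
Σ< zero    f = 0
Σ< (suc n) f = f 0 + Σ< n (λ i → f (suc i))

Σ<-cong-< : ∀ n {f g : Seq} → (∀ i → i < n → f i ≡ g i) → Σ< n f ≡ Σ< n g
Σ<-cong-< zero    eq = refl
Σ<-cong-< (suc n) eq = cong₂ _+_ (eq 0 z<s) (Σ<-cong-< n (λ i i<n → eq (suc i) (s<s i<n)))

Σ<-cong : ∀ n {f g : Seq} → f ≗ g → Σ< n f ≡ Σ< n g
Σ<-cong n f≗g = Σ<-cong-< n (λ i _ → f≗g i)

Σ<-zero : ∀ n {f : Seq} → (∀ i → i < n → f i ≡ 0) → Σ< n f ≡ 0
Σ<-zero zero    _ = refl
Σ<-zero (suc n) z rewrite z 0 z<s = Σ<-zero n (λ i i<n → z (suc i) (s<s i<n))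

Σ<-snoc : ∀ n f → Σ< (suc n) f ≡ Σ< n f + f n
Σ<-snoc zero    f = +-comm (f 0) 0
Σ<-snoc (suc n) f = begin
  f 0 + Σ< (suc n) (λ i → f (suc i))          ≡⟨ cong (f 0 +_) (Σ<-snoc n _) ⟩
  f 0 + (Σ< n (λ i → f (suc i)) + f (suc n))  ≡⟨ +-assoc (f 0) _ _ ⟨
  f 0 + Σ< n (λ i → f (suc i)) + f (suc n)    ∎

Σ<-+ : ∀ n f g → Σ< n (λ i → f i + g i) ≡ Σ< n f + Σ< n g
Σ<-+ zero    f g = refl
Σ<-+ (suc n) f g =
  trans (cong (f 0 + g 0 +_) (Σ<-+ n _ _)) (interchange (f 0) (g 0) _ _)

Σ<-*ˡ : ∀ n c f → Σ< n (λ i → c * f i) ≡ c * Σ< n f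
Σ<-*ˡ zero    c f = sym (*-zeroʳ c)
Σ<-*ˡ (suc n) c f = trans (cong (c * f 0 +_) (Σ<-*ˡ n c _)) (sym (*-distribˡ-+ c (f 0) _))

Σ<-*ʳ : ∀ n c f → Σ< n (λ i → f i * c) ≡ Σ< n f * c
Σ<-*ʳ n c f = begin
  Σ< n (λ i → f i * c)  ≡⟨ Σ<-cong n (λ i → *-comm (f i) c) ⟩
  Σ< n (λ i → c * f i)  ≡⟨ Σ<-*ˡ n c f ⟩
  c * Σ< n f            ≡⟨ *-comm c _ ⟩
  Σ< n f * c            ∎

Σ<-swap : ∀ m n (f : ℕ → ℕ → ℕ) →
          Σ< m (λ i → Σ< n (f i)) ≡ Σ< n (λ j → Σ< m (λ i → f i j))
Σ<-swap zero    n f = sym (Σ<-zero n (λ _ _ → refl))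
Σ<-swap (suc m) n f = begin
  Σ< n (f 0) + Σ< m (λ i → Σ< n (f (suc i)))           ≡⟨ cong (Σ< n (f 0) +_) (Σ<-swap m n _) ⟩
  Σ< n (f 0) + Σ< n (λ j → Σ< m (λ i → f (suc i) j))  ≡⟨ Σ<-+ n (f 0) _ ⟨
  Σ< n (λ j → f 0 j + Σ< m (λ i → f (suc i) j))        ∎

Σ<-extend : ∀ {m} n {f} → m ≤ n → (∀ i → m ≤ i → i < n → f i ≡ 0) → Σ< n f ≡ Σ< m f
Σ<-extend zero z≤n _ = refl
Σ<-extend {m} (suc n) {f} m≤1+n z with m≤n⇒m<n∨m≡n m≤1+n
... | inj₂ refl = refl
... | inj₁ (s≤s m≤n) = begin
  Σ< (suc n) f  ≡⟨ Σ<-snoc n f ⟩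
  Σ< n f + f n  ≡⟨ cong (Σ< n f +_) (z n m≤n ≤-refl) ⟩
  Σ< n f + 0    ≡⟨ +-identityʳ (Σ< n f) ⟩
  Σ< n f        ≡⟨ Σ<-extend {m} n m≤n (λ i m≤i i<n → z i m≤i (m<n⇒m<1+n i<n)) ⟩
  Σ< m f        ∎

Σ<-dropZeros : ∀ lo m {f} → (∀ i → i < lo → f i ≡ 0) → Σ< (lo + m) f ≡ Σ< m (λ i → f (lo + i))
Σ<-dropZeros zero    m z = refl
Σ<-dropZeros (suc lo) m z rewrite z 0 z<s = Σ<-dropZeros lo m (λ i i<lo → z (suc i) (s<s i<lo))

sumFromTo-unfold : ∀ {lo hi} f → lo ≤ hi → sumFromTo lo hi f ≡ f lo + sumFromTo (suc lo) hi f
sumFromTo-unfold {lo} {hi} f lo≤hi with suc hi ∸ lo in eq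
... | zero = contradiction (trans (sym eq) (+-∸-assoc 1 lo≤hi)) λ ()
... | suc m with refl ← suc-injective (trans (sym eq) (+-∸-assoc 1 lo≤hi)) = refl

sumFromTo-empty : ∀ {lo hi} f → hi < lo → sumFromTo lo hi f ≡ 0
sumFromTo-empty {lo} {hi} f hi<lo with suc hi ∸ lo in eq
... | zero = refl
... | suc m = contradiction (trans (sym eq) (m≤n⇒m∸n≡0 hi<lo)) λ ()

sumFromTo-Σ< : ∀ lo d f → sumFromTo lo (lo + d) f ≡ Σ< (suc d) (λ i → f (lo + i))
sumFromTo-Σ< lo zero f rewrite +-identityʳ lo =
  trans (sumFromTo-unfold f ≤-refl) (cong (f lo +_) (sumFromTo-empty f (n<1+n lo)))
sumFromTo-Σ< lo (suc d) f = begin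
  sumFromTo lo (lo + suc d) f
    ≡⟨ sumFromTo-unfold f (m≤m+n lo (suc d)) ⟩
  f lo + sumFromTo (suc lo) (lo + suc d) f
    ≡⟨ cong (λ h → f lo + sumFromTo (suc lo) h f) (+-suc lo d) ⟩
  f lo + sumFromTo (suc lo) (suc lo + d) f
    ≡⟨ cong₂ _+_ (cong f (sym (+-identityʳ lo))) (sumFromTo-Σ< (suc lo) d f) ⟩
  f (lo + 0) + Σ< (suc d) (λ i → f (suc lo + i))
    ≡⟨ cong (f (lo + 0) +_) (Σ<-cong (suc d) (λ i → cong f (+-suc lo i))) ⟨
  f (lo + 0) + Σ< (suc d) (λ i → f (lo + suc i)) ∎

sumFromTo≡Σ< : ∀ lo hi f → (∀ i → i < lo → f i ≡ 0) → sumFromTo lo hi f ≡ Σ< (suc hi) f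
sumFromTo≡Σ< lo hi f z with lo ≤? hi
... | no lo≰hi =
  trans (sumFromTo-empty f hi<lo) (sym (Σ<-zero (suc hi) (λ i i≤hi → z i (≤-trans i≤hi hi<lo))))
  where hi<lo = ≰⇒> lo≰hi
... | yes lo≤hi with m≤n⇒∃[o]m+o≡n lo≤hi
...   | d , refl = begin
  sumFromTo lo (lo + d) f         ≡⟨ sumFromTo-Σ< lo d f ⟩
  Σ< (suc d) (λ i → f (lo + i))   ≡⟨ Σ<-dropZeros lo (suc d) z ⟨
  Σ< (lo + suc d) f               ≡⟨ cong (λ m → Σ< m f) (+-suc lo d) ⟩
  Σ< (suc (lo + d)) f             ∎

-- On egfs, Δ is d/dx, θ is x·d/dx and ⋆ is the product; δ₀ and ι are the egfs 1 and x.

Δ : Seq → Seq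
Δ a n = a (suc n)

θ : Seq → Seq
θ a n = n * a n

infixl 7 _⋆_
infixr 8 _·_
infixl 6 _⊕_

_⊕_ : Seq → Seq → Seq
(a ⊕ b) n = a n + b n

_·_ : ℕ → Seq → Seq
(c · a) n = c * a n

_⋆_ : Seq → Seq → Seq
(a ⋆ b) n = Σ< (suc n) (λ p → (n C p) * a p * b (n ∸ p))

δ₀ : Seq
δ₀ zero    = 1
δ₀ (suc _) = 0

ι : Seq
ι zero          = 0
ι (suc zero)    = 1
ι (suc (suc _)) = 0

⋆-cong : ∀ {a a' b b'} → a ≗ a' → b ≗ b' → a ⋆ b ≗ a' ⋆ b'
⋆-cong a≗a' b≗b' n = Σ<-cong (suc n) (λ p → cong₂ (λ x y → (n C p) * x * y) (a≗a' p) (b≗b' (n ∸ p)))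

⋆-congˡ : ∀ {a a'} b → a ≗ a' → a ⋆ b ≗ a' ⋆ b
⋆-congˡ b a≗a' = ⋆-cong {b = b} {b' = b} a≗a' (λ _ → refl)

⋆-congʳ : ∀ a {b b'} → b ≗ b' → a ⋆ b ≗ a ⋆ b'
⋆-congʳ a b≗b' = ⋆-cong {a = a} {a' = a} (λ _ → refl) b≗b'

⋆-at-0 : ∀ a b → (a ⋆ b) 0 ≡ a 0 * b 0
⋆-at-0 a b = trans (+-identityʳ (1 * a 0 * b 0)) (cong (_* b 0) (*-identityˡ (a 0)))

⋆-distribʳ-⊕ : ∀ a a' b → (a ⊕ a') ⋆ b ≗ a ⋆ b ⊕ a' ⋆ b
⋆-distribʳ-⊕ a a' b n = trans (Σ<-cong (suc n) distrib)
  (Σ<-+ (suc n) (λ p → (n C p) * a p * b (n ∸ p)) (λ p → (n C p) * a' p * b (n ∸ p)))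
  where
  distrib : ∀ p → (n C p) * (a p + a' p) * b (n ∸ p) ≡ (n C p) * a p * b (n ∸ p) + (n C p) * a' p * b (n ∸ p)
  distrib p = trans (cong (_* b (n ∸ p)) (*-distribˡ-+ (n C p) (a p) (a' p)))
    (*-distribʳ-+ (b (n ∸ p)) ((n C p) * a p) ((n C p) * a' p))

⋆-distribˡ-⊕ : ∀ a b b' → a ⋆ (b ⊕ b') ≗ a ⋆ b ⊕ a ⋆ b'
⋆-distribˡ-⊕ a b b' n = trans (Σ<-cong (suc n) (λ p → *-distribˡ-+ ((n C p) * a p) (b (n ∸ p)) (b' (n ∸ p))))
  (Σ<-+ (suc n) (λ p → (n C p) * a p * b (n ∸ p)) (λ p → (n C p) * a p * b' (n ∸ p)))

⋆-·ʳ : ∀ c a b → a ⋆ c · b ≗ c · (a ⋆ b)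
⋆-·ʳ c a b n = trans (Σ<-cong (suc n) (λ p → x*[y*z]≡y*[x*z] ((n C p) * a p) c (b (n ∸ p))))
  (Σ<-*ˡ (suc n) c (λ p → (n C p) * a p * b (n ∸ p)))

-- The Pascal rule splits each binomial coefficient of (a ⋆ b)(n+1) between the two products.
⋆-leibniz : ∀ a b → Δ (a ⋆ b) ≗ Δ a ⋆ b ⊕ a ⋆ Δ b
⋆-leibniz a b n = begin
  head + Σ< (suc n) (λ p → (suc n C suc p) * a (suc p) * b (n ∸ p))
    ≡⟨ cong (head +_) (trans (Σ<-cong (suc n) pascal) (Σ<-+ (suc n) (λ p → (n C p) * a (suc p) * b (n ∸ p)) tail)) ⟩
  head + ((Δ a ⋆ b) n + Σ< (suc n) tail)
    ≡⟨ cong (λ z → head + ((Δ a ⋆ b) n + z)) (trans (Σ<-snoc n tail) (cong (Σ< n tail +_) tail-n)) ⟩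
  head + ((Δ a ⋆ b) n + (Σ< n tail + 0))
    ≡⟨ cong (λ z → head + ((Δ a ⋆ b) n + z)) (+-identityʳ (Σ< n tail)) ⟩
  head + ((Δ a ⋆ b) n + Σ< n tail)
    ≡⟨ x+[y+z]≡y+[x+z] head ((Δ a ⋆ b) n) (Σ< n tail) ⟩
  (Δ a ⋆ b) n + (head + Σ< n tail)
    ≡⟨ cong (λ z → (Δ a ⋆ b) n + (head + z)) (Σ<-cong-< n shift) ⟩
  (Δ a ⋆ b) n + (a ⋆ Δ b) n ∎
  where
  head : ℕ
  head = (n C 0) * a 0 * b (suc n)
  tail : Seq
  tail p = (n C suc p) * a (suc p) * b (n ∸ p)
  pascal : ∀ p → (suc n C suc p) * a (suc p) * b (n ∸ p) ≡ (n C p) * a (suc p) * b (n ∸ p) + tail p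
  pascal p = begin
    (suc n C suc p) * a (suc p) * b (n ∸ p)
      ≡⟨ cong (λ c → c * a (suc p) * b (n ∸ p)) (nCk+nC[k+1]≡[n+1]C[k+1] n p) ⟨
    (n C p + n C suc p) * a (suc p) * b (n ∸ p)
      ≡⟨ cong (_* b (n ∸ p)) (*-distribʳ-+ (a (suc p)) (n C p) (n C suc p)) ⟩
    ((n C p) * a (suc p) + (n C suc p) * a (suc p)) * b (n ∸ p)
      ≡⟨ *-distribʳ-+ (b (n ∸ p)) ((n C p) * a (suc p)) ((n C suc p) * a (suc p)) ⟩
    (n C p) * a (suc p) * b (n ∸ p) + tail p ∎
  tail-n : tail n ≡ 0
  tail-n rewrite k>n⇒nCk≡0 (n<1+n n) = refl
  shift : ∀ p → p < n → tail p ≡ (n C suc p) * a (suc p) * b (suc (n ∸ suc p))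
  shift p p<n = cong (λ m → (n C suc p) * a (suc p) * b m) (+-∸-assoc 1 p<n)

⋆-euler : ∀ a b → θ (a ⋆ b) ≗ θ a ⋆ b ⊕ a ⋆ θ b
⋆-euler a b n = begin
  n * (a ⋆ b) n
    ≡⟨ Σ<-*ˡ (suc n) n term ⟨
  Σ< (suc n) (λ p → n * term p)
    ≡⟨ Σ<-cong-< (suc n) split ⟩
  Σ< (suc n) (λ p → θ-left p + θ-right p)
    ≡⟨ Σ<-+ (suc n) θ-left θ-right ⟩
  (θ a ⋆ b) n + (a ⋆ θ b) n ∎
  where
  term θ-left θ-right : Seq
  term    p = (n C p) * a p * b (n ∸ p)
  θ-left  p = (n C p) * (p * a p) * b (n ∸ p)
  θ-right p = (n C p) * a p * ((n ∸ p) * b (n ∸ p))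
  distribute : ∀ p q x y z → (p + q) * (x * y * z) ≡ x * (p * y) * z + x * y * (q * z)
  distribute = solve-∀
  split : ∀ p → p < suc n → n * term p ≡ θ-left p + θ-right p
  split p p≤n = trans (cong (_* term p) (sym (m+[n∸m]≡n (s≤s⁻¹ p≤n))))
                      (distribute p (n ∸ p) (n C p) (a p) (b (n ∸ p)))

⋆-comm : ∀ a b → a ⋆ b ≗ b ⋆ a
⋆-comm a b zero = trans (⋆-at-0 a b) (trans (*-comm (a 0) (b 0)) (sym (⋆-at-0 b a)))
⋆-comm a b (suc n) = begin
  (a ⋆ b) (suc n)            ≡⟨ ⋆-leibniz a b n ⟩
  (Δ a ⋆ b) n + (a ⋆ Δ b) n  ≡⟨ cong₂ _+_ (⋆-comm (Δ a) b n) (⋆-comm a (Δ b) n) ⟩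
  (b ⋆ Δ a) n + (Δ b ⋆ a) n  ≡⟨ +-comm ((b ⋆ Δ a) n) ((Δ b ⋆ a) n) ⟩
  (Δ b ⋆ a) n + (b ⋆ Δ a) n  ≡⟨ ⋆-leibniz b a n ⟨
  (b ⋆ a) (suc n)            ∎

⋆-assoc : ∀ a b c → (a ⋆ b) ⋆ c ≗ a ⋆ (b ⋆ c)
⋆-assoc a b c zero = begin
  ((a ⋆ b) ⋆ c) 0      ≡⟨ ⋆-at-0 (a ⋆ b) c ⟩
  (a ⋆ b) 0 * c 0      ≡⟨ cong (_* c 0) (⋆-at-0 a b) ⟩
  a 0 * b 0 * c 0      ≡⟨ *-assoc (a 0) (b 0) (c 0) ⟩
  a 0 * (b 0 * c 0)    ≡⟨ cong (a 0 *_) (⋆-at-0 b c) ⟨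
  a 0 * (b ⋆ c) 0      ≡⟨ ⋆-at-0 a (b ⋆ c) ⟨
  (a ⋆ (b ⋆ c)) 0      ∎
⋆-assoc a b c (suc n) = begin
  ((a ⋆ b) ⋆ c) (suc n)
    ≡⟨ ⋆-leibniz (a ⋆ b) c n ⟩
  (Δ (a ⋆ b) ⋆ c) n + ((a ⋆ b) ⋆ Δ c) n
    ≡⟨ cong (_+ ((a ⋆ b) ⋆ Δ c) n) (trans (⋆-congˡ c (⋆-leibniz a b) n) (⋆-distribʳ-⊕ (Δ a ⋆ b) (a ⋆ Δ b) c n)) ⟩
  ((Δ a ⋆ b) ⋆ c) n + ((a ⋆ Δ b) ⋆ c) n + ((a ⋆ b) ⋆ Δ c) n
    ≡⟨ cong₂ _+_ (cong₂ _+_ (⋆-assoc (Δ a) b c n) (⋆-assoc a (Δ b) c n)) (⋆-assoc a b (Δ c) n) ⟩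
  (Δ a ⋆ (b ⋆ c)) n + (a ⋆ (Δ b ⋆ c)) n + (a ⋆ (b ⋆ Δ c)) n
    ≡⟨ +-assoc ((Δ a ⋆ (b ⋆ c)) n) ((a ⋆ (Δ b ⋆ c)) n) ((a ⋆ (b ⋆ Δ c)) n) ⟩
  (Δ a ⋆ (b ⋆ c)) n + ((a ⋆ (Δ b ⋆ c)) n + (a ⋆ (b ⋆ Δ c)) n)
    ≡⟨ cong ((Δ a ⋆ (b ⋆ c)) n +_) (trans (⋆-congʳ a (⋆-leibniz b c) n) (⋆-distribˡ-⊕ a (Δ b ⋆ c) (b ⋆ Δ c) n)) ⟨
  (Δ a ⋆ (b ⋆ c)) n + (a ⋆ Δ (b ⋆ c)) n
    ≡⟨ ⋆-leibniz a (b ⋆ c) n ⟨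
  (a ⋆ (b ⋆ c)) (suc n) ∎

⋆-identityˡ : ∀ a → δ₀ ⋆ a ≗ a
⋆-identityˡ a n = begin
  1 * a n + Σ< n (λ p → (n C suc p) * 0 * a (n ∸ suc p))
    ≡⟨ cong₂ _+_ (*-identityˡ (a n)) (Σ<-zero n (λ p _ → cong (_* a (n ∸ suc p)) (*-zeroʳ (n C suc p)))) ⟩
  a n + 0
    ≡⟨ +-identityʳ (a n) ⟩
  a n ∎

⋆-identityʳ : ∀ a → a ⋆ δ₀ ≗ a
⋆-identityʳ a n = trans (⋆-comm a δ₀ n) (⋆-identityˡ a n)

ι-⋆ : ∀ b m → (ι ⋆ b) (suc m) ≡ suc m * b m
ι-⋆ b m = begin
  (suc m C 1) * 1 * b m + Σ< m (λ p → (suc m C suc (suc p)) * 0 * b (m ∸ suc p))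
    ≡⟨ cong₂ _+_ (cong (λ c → c * 1 * b m) (nC1≡n (suc m)))
                 (Σ<-zero m (λ p _ → cong (_* b (m ∸ suc p)) (*-zeroʳ (suc m C suc (suc p))))) ⟩
  suc m * 1 * b m + 0
    ≡⟨ +-identityʳ (suc m * 1 * b m) ⟩
  suc m * 1 * b m
    ≡⟨ cong (_* b m) (*-identityʳ (suc m)) ⟩
  suc m * b m ∎

S-above : ∀ {n k} → n < k → S n k ≡ 0
S-above {zero}  {suc k} _ = refl
S-above {suc n} {suc k} (s<s n<k) rewrite S-above (m<n⇒m<1+n n<k) | S-above n<k =
  trans (+-identityʳ _) (*-zeroʳ k)

S-zeroʳ : ∀ n → S n 0 ≡ δ₀ n
S-zeroʳ zero    = refl
S-zeroʳ (suc n) = refl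

S-suc-1 : ∀ i → S (suc i) 1 ≡ 1
S-suc-1 zero = refl
S-suc-1 (suc i) rewrite S-suc-1 i = refl

𝒮 : Seq → Seq
𝒮 a n = Σ< (suc n) (λ i → S n i * a i)

𝒮-cong : ∀ {a a'} → a ≗ a' → 𝒮 a ≗ 𝒮 a'
𝒮-cong a≗a' n = Σ<-cong (suc n) (λ i → cong (S n i *_) (a≗a' i))

𝒮-at-0 : ∀ a → 𝒮 a 0 ≡ a 0
𝒮-at-0 a = trans (+-identityʳ (1 * a 0)) (*-identityˡ (a 0))

𝒮-⊕ : ∀ a b → 𝒮 (a ⊕ b) ≗ 𝒮 a ⊕ 𝒮 b
𝒮-⊕ a b n = trans (Σ<-cong (suc n) (λ i → *-distribˡ-+ (S n i) (a i) (b i)))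
  (Σ<-+ (suc n) (λ i → S n i * a i) (λ i → S n i * b i))

𝒮-· : ∀ c a → 𝒮 (c · a) ≗ c · 𝒮 a
𝒮-· c a n = trans (Σ<-cong (suc n) (λ i → x*[y*z]≡y*[x*z] (S n i) c (a i)))
  (Σ<-*ˡ (suc n) c (λ i → S n i * a i))

𝒮-δ₀ : 𝒮 δ₀ ≗ δ₀
𝒮-δ₀ n = begin
  S n 0 * 1 + Σ< n (λ i → S n (suc i) * 0)
    ≡⟨ cong₂ _+_ (*-identityʳ (S n 0)) (Σ<-zero n (λ i _ → *-zeroʳ (S n (suc i)))) ⟩
  S n 0 + 0
    ≡⟨ +-identityʳ (S n 0) ⟩
  S n 0
    ≡⟨ S-zeroʳ n ⟩
  δ₀ n ∎

-- The Stirling recurrence is the chain rule (A(eˣ − 1))′ = (eˣ − 1) A′(eˣ − 1) + A′(eˣ − 1).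
𝒮-Δ : ∀ a → Δ (𝒮 a) ≗ 𝒮 (θ a) ⊕ 𝒮 (Δ a)
𝒮-Δ a n = begin
  Σ< (suc n) (λ i → (suc i * S n (suc i) + S n i) * a (suc i))
    ≡⟨ Σ<-cong (suc n) (λ i → *-distribʳ-+ (a (suc i)) (suc i * S n (suc i)) (S n i)) ⟩
  Σ< (suc n) (λ i → weighted i + S n i * a (suc i))
    ≡⟨ Σ<-+ (suc n) weighted (λ i → S n i * a (suc i)) ⟩
  Σ< (suc n) weighted + 𝒮 (Δ a) n
    ≡⟨ cong (_+ 𝒮 (Δ a) n) (trans (Σ<-snoc n weighted) (cong (Σ< n weighted +_) weighted-n)) ⟩
  Σ< n weighted + 0 + 𝒮 (Δ a) n
    ≡⟨ cong (_+ 𝒮 (Δ a) n) (+-identityʳ (Σ< n weighted)) ⟩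
  Σ< n weighted + 𝒮 (Δ a) n
    ≡⟨ cong (_+ 𝒮 (Δ a) n) (Σ<-cong n reorder) ⟩
  Σ< n (λ i → S n (suc i) * (suc i * a (suc i))) + 𝒮 (Δ a) n
    ≡⟨ cong (λ z → z + Σ< n (λ i → S n (suc i) * (suc i * a (suc i))) + 𝒮 (Δ a) n) (*-zeroʳ (S n 0)) ⟨
  𝒮 (θ a) n + 𝒮 (Δ a) n ∎
  where
  weighted : Seq
  weighted i = suc i * S n (suc i) * a (suc i)
  weighted-n : weighted n ≡ 0
  weighted-n rewrite S-above (n<1+n n) | *-zeroʳ n = refl
  reorder : ∀ i → weighted i ≡ S n (suc i) * (suc i * a (suc i))
  reorder i = trans (cong (_* a (suc i)) (*-comm (suc i) (S n (suc i)))) (*-assoc (S n (suc i)) (suc i) (a (suc i)))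

𝒮-⋆ : ∀ a b → 𝒮 (a ⋆ b) ≗ 𝒮 a ⋆ 𝒮 b
𝒮-⋆ a b zero = begin
  𝒮 (a ⋆ b) 0        ≡⟨ 𝒮-at-0 (a ⋆ b) ⟩
  (a ⋆ b) 0          ≡⟨ ⋆-at-0 a b ⟩
  a 0 * b 0          ≡⟨ cong₂ _*_ (𝒮-at-0 a) (𝒮-at-0 b) ⟨
  𝒮 a 0 * 𝒮 b 0      ≡⟨ ⋆-at-0 (𝒮 a) (𝒮 b) ⟨
  (𝒮 a ⋆ 𝒮 b) 0      ∎
𝒮-⋆ a b (suc n) = begin
  𝒮 (a ⋆ b) (suc n)
    ≡⟨ 𝒮-Δ (a ⋆ b) n ⟩
  𝒮 (θ (a ⋆ b)) n + 𝒮 (Δ (a ⋆ b)) n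
    ≡⟨ cong₂ _+_ (trans (𝒮-cong (⋆-euler a b) n) (𝒮-⊕ (θ a ⋆ b) (a ⋆ θ b) n))
                 (trans (𝒮-cong (⋆-leibniz a b) n) (𝒮-⊕ (Δ a ⋆ b) (a ⋆ Δ b) n)) ⟩
  (𝒮 (θ a ⋆ b) n + 𝒮 (a ⋆ θ b) n) + (𝒮 (Δ a ⋆ b) n + 𝒮 (a ⋆ Δ b) n)
    ≡⟨ cong₂ _+_ (cong₂ _+_ (𝒮-⋆ (θ a) b n) (𝒮-⋆ a (θ b) n)) (cong₂ _+_ (𝒮-⋆ (Δ a) b n) (𝒮-⋆ a (Δ b) n)) ⟩
  ((𝒮 (θ a) ⋆ 𝒮 b) n + (𝒮 a ⋆ 𝒮 (θ b)) n) + ((𝒮 (Δ a) ⋆ 𝒮 b) n + (𝒮 a ⋆ 𝒮 (Δ b)) n)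
    ≡⟨ interchange ((𝒮 (θ a) ⋆ 𝒮 b) n) _ _ _ ⟩
  ((𝒮 (θ a) ⋆ 𝒮 b) n + (𝒮 (Δ a) ⋆ 𝒮 b) n) + ((𝒮 a ⋆ 𝒮 (θ b)) n + (𝒮 a ⋆ 𝒮 (Δ b)) n)
    ≡⟨ cong₂ _+_ (⋆-distribʳ-⊕ (𝒮 (θ a)) (𝒮 (Δ a)) (𝒮 b) n) (⋆-distribˡ-⊕ (𝒮 a) (𝒮 (θ b)) (𝒮 (Δ b)) n) ⟨
  ((𝒮 (θ a) ⊕ 𝒮 (Δ a)) ⋆ 𝒮 b) n + (𝒮 a ⋆ (𝒮 (θ b) ⊕ 𝒮 (Δ b))) n
    ≡⟨ cong₂ _+_ (⋆-congˡ (𝒮 b) (𝒮-Δ a) n) (⋆-congʳ (𝒮 a) (𝒮-Δ b) n) ⟨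
  (Δ (𝒮 a) ⋆ 𝒮 b) n + (𝒮 a ⋆ Δ (𝒮 b)) n
    ≡⟨ ⋆-leibniz (𝒮 a) (𝒮 b) n ⟨
  (𝒮 a ⋆ 𝒮 b) (suc n) ∎

Tseq : ℕ → ℕ → Seq
Tseq k r n = T n k r

T-0-diag : ∀ n → T n 0 n ≡ 1
T-0-diag n with n ≟ n
... | yes _  = refl
... | no n≢n = contradiction refl n≢n

T-0-off : ∀ {n r} → n ≢ r → T n 0 r ≡ 0
T-0-off {n} {r} n≢r with n ≟ r
... | yes n≡r = contradiction n≡r n≢r
... | no _    = refl

T-0-sym : ∀ n r → T n 0 r ≡ T r 0 n
T-0-sym n r = by-cases (n ≟ r)
  where
  by-cases : Dec (n ≡ r) → T n 0 r ≡ T r 0 n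
  by-cases (yes refl) = refl
  by-cases (no n≢r)   = trans (T-0-off n≢r) (sym (T-0-off (n≢r ∘ sym)))

T-below : ∀ k {i r} → i < r → T i k r ≡ 0
T-below zero    i<r = T-0-off (<⇒≢ i<r)
T-below (suc k) i<r = sumFromTo-empty _ i<r

T-suc≡𝒮 : ∀ k r → Tseq (suc k) r ≗ 𝒮 (Tseq k r)
T-suc≡𝒮 k r n = sumFromTo≡Σ< r n (λ i → S n i * T i k r) vanishes
  where
  vanishes : ∀ i → i < r → S n i * T i k r ≡ 0
  vanishes i i<r = trans (cong (S n i *_) (T-below k i<r)) (*-zeroʳ (S n i))

Σ<-sift-below : ∀ N (f : Seq) r → N ≤ r → Σ< N (λ i → f i * T i 0 r) ≡ 0
Σ<-sift-below N f r N≤r = Σ<-zero N vanishes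
  where
  vanishes : ∀ i → i < N → f i * T i 0 r ≡ 0
  vanishes i i<N = trans (cong (f i *_) (T-0-off (<⇒≢ (<-≤-trans i<N N≤r)))) (*-zeroʳ (f i))

Σ<-sift : ∀ N (f : Seq) r → r < N → Σ< N (λ i → f i * T i 0 r) ≡ f r
Σ<-sift (suc N) f r (s≤s r≤N) with m≤n⇒m<n∨m≡n r≤N
... | inj₁ r<N = begin
  Σ< (suc N) (λ i → f i * T i 0 r)
    ≡⟨ Σ<-snoc N (λ i → f i * T i 0 r) ⟩
  Σ< N (λ i → f i * T i 0 r) + f N * T N 0 r
    ≡⟨ cong₂ _+_ (Σ<-sift N f r r<N) (cong (f N *_) (T-0-off (<⇒≢ r<N ∘ sym))) ⟩
  f r + f N * 0
    ≡⟨ cong (f r +_) (*-zeroʳ (f N)) ⟩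
  f r + 0
    ≡⟨ +-identityʳ (f r) ⟩
  f r ∎
... | inj₂ refl = begin
  Σ< (suc N) (λ i → f i * T i 0 N)
    ≡⟨ Σ<-snoc N (λ i → f i * T i 0 N) ⟩
  Σ< N (λ i → f i * T i 0 N) + f N * T N 0 N
    ≡⟨ cong₂ _+_ (Σ<-sift-below N f N ≤-refl) (cong (f N *_) (T-0-diag N)) ⟩
  f N * 1
    ≡⟨ *-identityʳ (f N) ⟩
  f N ∎

T-1≡S : ∀ n r → T n 1 r ≡ S n r
T-1≡S n r with r ≤? n
... | yes r≤n = trans (T-suc≡𝒮 0 r n) (Σ<-sift (suc n) (S n) r (s≤s r≤n))
... | no r≰n  = begin
  T n 1 r                                ≡⟨ T-suc≡𝒮 0 r n ⟩
  Σ< (suc n) (λ i → S n i * T i 0 r)     ≡⟨ Σ<-sift-below (suc n) (S n) r (≰⇒> r≰n) ⟩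
  0                                      ≡⟨ S-above (≰⇒> r≰n) ⟨
  S n r                                  ∎

Tseq-k-0 : ∀ k → Tseq k 0 ≗ δ₀
Tseq-k-0 zero    zero    = T-0-diag 0
Tseq-k-0 zero    (suc n) = refl
Tseq-k-0 (suc k) n = trans (T-suc≡𝒮 k 0 n) (trans (𝒮-cong (Tseq-k-0 k) n) (𝒮-δ₀ n))

Tseq-0-1 : Tseq 0 1 ≗ ι
Tseq-0-1 zero          = refl
Tseq-0-1 (suc zero)    = T-0-diag 1
Tseq-0-1 (suc (suc n)) = refl

-- The coefficient form of (r+1) · fʳ⁺¹/(r+1)! = f · fʳ/r!.
Tseq-power : ∀ k r → suc r · Tseq k (suc r) ≗ Tseq k 1 ⋆ Tseq k r
Tseq-power zero r zero = *-zeroʳ (suc r)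
Tseq-power zero r (suc m) = begin
  suc r * T (suc m) 0 (suc r)  ≡⟨ diagonal-shift (m ≟ r) ⟩
  suc m * T m 0 r              ≡⟨ ι-⋆ (Tseq 0 r) m ⟨
  (ι ⋆ Tseq 0 r) (suc m)       ≡⟨ ⋆-congˡ (Tseq 0 r) Tseq-0-1 (suc m) ⟨
  (Tseq 0 1 ⋆ Tseq 0 r) (suc m) ∎
  where
  diagonal-shift : Dec (m ≡ r) → suc r * T (suc m) 0 (suc r) ≡ suc m * T m 0 r
  diagonal-shift (yes refl) = cong (suc m *_) (trans (T-0-diag (suc m)) (sym (T-0-diag m)))
  diagonal-shift (no m≢r) = begin
    suc r * T (suc m) 0 (suc r)  ≡⟨ cong (suc r *_) (T-0-off {suc m} {suc r} (m≢r ∘ suc-injective)) ⟩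
    suc r * 0                    ≡⟨ *-zeroʳ (suc r) ⟩
    0                            ≡⟨ *-zeroʳ (suc m) ⟨
    suc m * 0                    ≡⟨ cong (suc m *_) (T-0-off {m} {r} m≢r) ⟨
    suc m * T m 0 r              ∎
Tseq-power (suc k) r n = begin
  suc r * T n (suc k) (suc r)               ≡⟨ cong (suc r *_) (T-suc≡𝒮 k (suc r) n) ⟩
  suc r * 𝒮 (Tseq k (suc r)) n              ≡⟨ 𝒮-· (suc r) (Tseq k (suc r)) n ⟨
  𝒮 (suc r · Tseq k (suc r)) n              ≡⟨ 𝒮-cong (Tseq-power k r) n ⟩
  𝒮 (Tseq k 1 ⋆ Tseq k r) n                 ≡⟨ 𝒮-⋆ (Tseq k 1) (Tseq k r) n ⟩
  (𝒮 (Tseq k 1) ⋆ 𝒮 (Tseq k r)) n          ≡⟨ ⋆-cong (T-suc≡𝒮 k 1) (T-suc≡𝒮 k r) n ⟨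
  (Tseq (suc k) 1 ⋆ Tseq (suc k) r) n      ∎

-- Differentiating fʳ⁺¹/(r+1)! gives f′ · fʳ/r!; the factor r + 1 is cancelled against Tseq-power.
Tseq-Δ : ∀ k r → Δ (Tseq k (suc r)) ≗ Δ (Tseq k 1) ⋆ Tseq k r
Tseq-Δ k zero n = sym (trans (⋆-congʳ (Δ (Tseq k 1)) (Tseq-k-0 k) n) (⋆-identityʳ (Δ (Tseq k 1)) n))
Tseq-Δ k (suc r) n = *-cancelˡ-≡ _ _ (suc (suc r)) (begin
  suc (suc r) * T (suc n) k (suc (suc r))    ≡⟨ Tseq-power k (suc r) (suc n) ⟩
  (f ⋆ Tseq k (suc r)) (suc n)               ≡⟨ ⋆-leibniz f (Tseq k (suc r)) n ⟩
  (Δ f ⋆ Tseq k (suc r)) n + (f ⋆ Δ (Tseq k (suc r))) n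
                                             ≡⟨ cong ((Δ f ⋆ Tseq k (suc r)) n +_) f⋆Δfʳ⁺¹ ⟩
  (Δ f ⋆ Tseq k (suc r)) n + suc r * (Δ f ⋆ Tseq k (suc r)) n  ∎)
  where
  f : Seq
  f = Tseq k 1
  f⋆Δfʳ⁺¹ : (f ⋆ Δ (Tseq k (suc r))) n ≡ suc r * (Δ f ⋆ Tseq k (suc r)) n
  f⋆Δfʳ⁺¹ = begin
    (f ⋆ Δ (Tseq k (suc r))) n         ≡⟨ ⋆-congʳ f (Tseq-Δ k r) n ⟩
    (f ⋆ (Δ f ⋆ Tseq k r)) n           ≡⟨ ⋆-assoc f (Δ f) (Tseq k r) n ⟨
    ((f ⋆ Δ f) ⋆ Tseq k r) n           ≡⟨ ⋆-congˡ (Tseq k r) (⋆-comm f (Δ f)) n ⟩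
    ((Δ f ⋆ f) ⋆ Tseq k r) n           ≡⟨ ⋆-assoc (Δ f) f (Tseq k r) n ⟩
    (Δ f ⋆ (f ⋆ Tseq k r)) n           ≡⟨ ⋆-congʳ (Δ f) (Tseq-power k r) n ⟨
    (Δ f ⋆ suc r · Tseq k (suc r)) n   ≡⟨ ⋆-·ʳ (suc r) (Δ f) (Tseq k (suc r)) n ⟩
    suc r * (Δ f ⋆ Tseq k (suc r)) n   ∎

T-suc-last : ∀ k n r → T n (suc k) r ≡ Σ< (suc n) (λ i → T n k i * S i r)
T-suc-last zero n r = begin
  T n 1 r                                ≡⟨ T-1≡S n r ⟩
  S n r                                  ≡⟨ Σ<-sift (suc n) (λ i → S i r) n (n<1+n n) ⟨
  Σ< (suc n) (λ i → S i r * T i 0 n)     ≡⟨ Σ<-cong (suc n) transpose ⟩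
  Σ< (suc n) (λ i → T n 0 i * S i r)     ∎
  where
  transpose : ∀ i → S i r * T i 0 n ≡ T n 0 i * S i r
  transpose i = trans (*-comm (S i r) (T i 0 n)) (cong (_* S i r) (T-0-sym i n))
T-suc-last (suc k) n r = begin
  T n (suc (suc k)) r
    ≡⟨ T-suc≡𝒮 (suc k) r n ⟩
  Σ< (suc n) (λ j → S n j * T j (suc k) r)
    ≡⟨ Σ<-cong-< (suc n) (λ j j≤n → cong (S n j *_) (trans (T-suc-last k j r) (sym (padded j j≤n)))) ⟩
  Σ< (suc n) (λ j → S n j * Σ< (suc n) (λ i → T j k i * S i r))
    ≡⟨ Σ<-cong (suc n) (λ j → Σ<-*ˡ (suc n) (S n j) (λ i → T j k i * S i r)) ⟨
  Σ< (suc n) (λ j → Σ< (suc n) (λ i → S n j * (T j k i * S i r)))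
    ≡⟨ Σ<-swap (suc n) (suc n) (λ j i → S n j * (T j k i * S i r)) ⟩
  Σ< (suc n) (λ i → Σ< (suc n) (λ j → S n j * (T j k i * S i r)))
    ≡⟨ Σ<-cong (suc n) factor-S ⟩
  Σ< (suc n) (λ i → 𝒮 (Tseq k i) n * S i r)
    ≡⟨ Σ<-cong (suc n) (λ i → cong (_* S i r) (T-suc≡𝒮 k i n)) ⟨
  Σ< (suc n) (λ i → T n (suc k) i * S i r) ∎
  where
  factor-S : ∀ i → Σ< (suc n) (λ j → S n j * (T j k i * S i r)) ≡ 𝒮 (Tseq k i) n * S i r
  factor-S i = trans (Σ<-cong (suc n) (λ j → sym (*-assoc (S n j) (T j k i) (S i r))))
                     (Σ<-*ʳ (suc n) (S i r) (λ j → S n j * T j k i))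
  padded : ∀ j → j < suc n → Σ< (suc n) (λ i → T j k i * S i r) ≡ Σ< (suc j) (λ i → T j k i * S i r)
  padded j j≤n = Σ<-extend (suc n) j≤n (λ i j<i _ → cong (_* S i r) (T-below k j<i))

T-diag-1 : ∀ k → T 1 k 1 ≡ 1
T-diag-1 zero = T-0-diag 1
T-diag-1 (suc k) rewrite T-suc≡𝒮 k 1 1 | T-diag-1 k = refl

T-binomial-recurrence : (k n r : ℕ) → k ≥ 1 → 1 ≤ r → r ≤ n →
  T n k r ≡ sumFromTo 0 (n ∸ r) (λ p → ((n ∸ 1) C p) * T (p + 1) k 1 * T (n ∸ p ∸ 1) k (r ∸ 1))
T-binomial-recurrence k (suc n) (suc r) _ _ (s≤s r≤n) = begin
  T (suc n) k (suc r)                  ≡⟨ Tseq-Δ k r n ⟩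
  Σ< (suc n) term                      ≡⟨ Σ<-extend (suc n) (s≤s (m∸n≤m n r)) term-vanishes ⟩
  Σ< (suc (n ∸ r)) term                ≡⟨ Σ<-cong-< (suc (n ∸ r)) reindex ⟨
  Σ< (suc (n ∸ r)) summand             ≡⟨ sumFromTo-Σ< 0 (n ∸ r) summand ⟨
  sumFromTo 0 (n ∸ r) summand          ∎
  where
  summand : Seq
  summand p = ((suc n ∸ 1) C p) * T (p + 1) k 1 * T (suc n ∸ p ∸ 1) k (suc r ∸ 1)
  term : Seq
  term p = (n C p) * T (suc p) k 1 * T (n ∸ p) k r
  term-vanishes : ∀ i → suc (n ∸ r) ≤ i → i < suc n → term i ≡ 0
  term-vanishes i n∸r<i (s≤s i≤n) =
    trans (cong ((n C i) * T (suc i) k 1 *_) (T-below k n∸i<r)) (*-zeroʳ ((n C i) * T (suc i) k 1))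
    where n∸i<r = subst (n ∸ i <_) (m∸[m∸n]≡n r≤n) (∸-monoʳ-< n∸r<i i≤n)
  reindex : ∀ p → p < suc (n ∸ r) → summand p ≡ term p
  reindex p p≤n∸r = cong₂ (λ i j → (n C p) * T i k 1 * T j k r)
    (+-comm p 1) (cong (_∸ 1) (+-∸-assoc 1 (≤-trans (s≤s⁻¹ p≤n∸r) (m∸n≤m n r))))

T-column-1 : (k n : ℕ) → k ≥ 2 → n ≥ 1 → T n k 1 ≡ sumFromTo 1 n (λ r → T n (k ∸ 1) r)
T-column-1 (suc zero)    _       (s≤s ()) _
T-column-1 (suc (suc k)) (suc n) _        _ = begin
  T (suc n) (suc (suc k)) 1
    ≡⟨ T-suc-last (suc k) (suc n) 1 ⟩
  T (suc n) (suc k) 0 * 0 + Σ< (suc n) (λ i → T (suc n) (suc k) (suc i) * S (suc i) 1)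
    ≡⟨ cong₂ _+_ (*-zeroʳ (T (suc n) (suc k) 0)) (Σ<-cong (suc n) drop-S-1) ⟩
  Σ< (suc n) (λ i → T (suc n) (suc k) (suc i))
    ≡⟨ sumFromTo-Σ< 1 n (λ r → T (suc n) (suc k) r) ⟨
  sumFromTo 1 (suc n) (λ r → T (suc n) (suc k) r) ∎
  where
  drop-S-1 : ∀ i → T (suc n) (suc k) (suc i) * S (suc i) 1 ≡ T (suc n) (suc k) (suc i)
  drop-S-1 i = trans (cong (T (suc n) (suc k) (suc i) *_) (S-suc-1 i)) (*-identityʳ _)

mainTheorem10 :
    ((k n r : ℕ) → k ≥ 1 → 1 ≤ r → r ≤ n →
      T n k r ≡ sumFromTo 0 (n ∸ r)
                  (λ p → ((n ∸ 1) C p) * T (p + 1) k 1 * T (n ∸ p ∸ 1) k (r ∸ 1)))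
    × ((k n : ℕ) → k ≥ 2 → n ≥ 1 →
      T n k 1 ≡ sumFromTo 1 n (λ r → T n (k ∸ 1) r))
    × ((k : ℕ) → k ≥ 1 → T 0 k 0 ≡ 1)
    × ((k : ℕ) → k ≥ 1 → T 1 k 1 ≡ 1)
mainTheorem10 =
  T-binomial-recurrence , T-column-1 , (λ k _ → Tseq-k-0 k 0) , (λ k _ → T-diag-1 k)
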